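{- Let $T$ and $U$ be objects such that $T$ is feasible relative to $U$. Let $A$ be an algorithm that is $k$-throughput-competitive for $T$ relative to $U$, and let $B$ be an algorithm implementing $U$ that is $l$-throughput-competitive for $U$. Then $A\circ B$ is $kl$-throughput-competitive for $T$.
   Context: Model: $n$ processes communicate through atomic single-writer multi-reader registers; an execution is an interleaved sequence of steps, each a read or a write of one register. A schedule is a sequence of process identifiers specifying which process takes each successive step (chosen by an adversary). An object is an abstract concurrent data structure manipulated by tasks; each task instance has a well-defined initial operation and final operation (recognizable when executed), and there is a correctness predicate on executions; a correct implementation is one all of whose executions satisfy it. Each process has a (sufficiently long) request sequence of tasks, supplied separately from the schedule; a process starts its next task as soon as its previous one finishes. For an algorithm $A$, schedule $\sigma$ and set of request sequences $R$, $\mathrm{done}(A,\sigma,R)$ is the total number of tasks completed by all processes when running $A$ under $\sigma$ with requests $R$. For an object $T$, $\mathrm{opt}_T(\sigma)=\max_{A^*,R^*}\mathrm{done}(A^*,\sigma,R^*)$, where $A^*$ ranges over all correct implementations of $T$ and $R^*$ over all sets of request sequences of $T$-tasks. An algorithm $A$ implementing $T$ is $k$-throughput-competitive for $T$ if there is a constant $c$ such that for every schedule $\sigma$ and set of request sequences $R$, $\mathrm{done}(A,\sigma,R)+c\ge \frac1k\mathrm{opt}_T(\sigma)$. If $A$ implements $T$ using a subroutine implementing object $U$ (and executes no operations other than those provided by $U$), and $B$ implements $U$, then $A\circ B$ denotes the algorithm obtained by running $B$ whenever $A$ needs to carry out a $U$-task; $R_A$ denotes the request sequences of $U$-tasks corresponding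 to the subroutine calls made by $A$ when running according to $R$ and $\sigma$. $A$ is $k$-throughput-competitive for $T$ relative to $U$ if there is a constant $c$ such that for every $B$ implementing $U$, every schedule $\sigma$ and request sequences $R$ for which the ratios are defined, $$\frac{\mathrm{done}(A\circ B,\sigma,R)+c}{\mathrm{done}(B,\sigma,R_A)}\ge \frac1k\cdot\frac{\mathrm{opt}_T(\sigma)}{\mathrm{opt}_U(\sigma)}.$$ $T$ is feasible relative to $U$ if there is a constant $c$ such that $\mathrm{opt}_T(\sigma)\le c\cdot \mathrm{opt}_U(\sigma)$ for all schedules $\sigma$.
   Formalization: The competitive ratios k and l range over the positive rationals. -}

module Defs where

open import Level using (Level; suc; _⊔_)
open import Data.Nat using (ℕ)
import Data.Nat as ℕ
open import Data.Integer using (+_)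
open import Data.Rational using (ℚ; _/_; _+_; _*_; _≤_; _<_; 0ℚ)
open import Data.Product using (Σ; ∃; ∃₂; _×_)
open import Relation.Binary.PropositionalEquality using (_≡_)
open import Relation.Nullary using (¬_)

⟦_⟧ : ℕ → ℚ
⟦ n ⟧ = + n / 1

-- An abstract shared-memory computing model, exposing exactly the data used
-- by the paper's definitions of throughput-competitiveness.
record Model : Set₁ where
  field
    Schedule  : Set            -- schedules σ (finite sequences of process ids)
    Obj       : Set
    Alg       : Set
    Req       : Set            -- sets of request sequences (one per process)
    ReqOf     : Obj → Req → Set          -- R consists of request sequences of T-tasks
    Implements : Alg → Obj → Set
    Uses      : Alg → Obj → Obj → Set    -- A implements T using (only) a subroutine for U
    _∘ᴬ_      : Alg → Alg → Alg
    callReqs  : Alg → Schedule → Req → Req   -- R_A : the U-requests issued by A under σ, R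
    done      : Alg → Schedule → Req → ℕ
    callReqs-ReqOf : ∀ {A T U σ R} → Uses A T U → ReqOf T R → ReqOf U (callReqs A σ R)
    -- the maximum defining opt_T(σ) exists (done is bounded by the schedule length)
    optExists : ∀ (T : Obj) (σ : Schedule) → Σ ℕ λ m →
      (∃₂ λ A R → Implements A T × ReqOf T R × done A σ R ≡ m) ×
      (∀ A R → Implements A T → ReqOf T R → done A σ R ℕ.≤ m)

module _ (M : Model) where
  open Model M

  opt : Obj → Schedule → ℕ
  opt T σ = Data.Product.proj₁ (optExists T σ)

  Feasible : Obj → Obj → Set
  Feasible T U = ∃ λ (c : ℚ) → ∀ σ → ⟦ opt T σ ⟧ ≤ c * ⟦ opt U σ ⟧

  -- A (implementing T) is k-throughput-competitive for T  (k > 0):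
  --   done(A,σ,R) + c ≥ (1/k) opt_T(σ), written as opt_T(σ) ≤ k (done(A,σ,R) + c)
  Competitive : Alg → Obj → ℚ → Set
  Competitive A T k = ∃ λ (c : ℚ) → ∀ σ R → ReqOf T R →
    ⟦ opt T σ ⟧ ≤ k * (⟦ done A σ R ⟧ + c)

  -- A is k-throughput-competitive for T relative to U:
  --   (done(A∘B,σ,R)+c)/done(B,σ,R_A) ≥ (1/k) opt_T(σ)/opt_U(σ) whenever both ratios are
  --   defined (nonzero denominators), written with denominators cleared (k > 0).
  RelCompetitive : Alg → Obj → Obj → ℚ → Set
  RelCompetitive A T U k = ∃ λ (c : ℚ) → ∀ B → Implements B U → ∀ σ R → ReqOf T R →
    ¬ (done B σ (callReqs A σ R) ≡ 0) → ¬ (opt U σ ≡ 0) →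
    ⟦ opt T σ ⟧ * ⟦ done B σ (callReqs A σ R) ⟧
      ≤ k * ((⟦ done (A ∘ᴬ B) σ R ⟧ + c) * ⟦ opt U σ ⟧)

-- Write P = opt_T σ, q = opt_U σ, d = done(B, σ, R_A), D = done(A ∘ B, σ, R).  Relative
-- competitiveness gives P d ≤ k (D + c) q and competitiveness of B gives q ≤ l (d + c_B).
-- Multiplying P by the second bound, the term P d is controlled by the first and the
-- leftover P c_B by feasibility P ≤ c_F q; cancelling q yields P ≤ k l (D + c + c_F c_B / k).
-- Feasibility also settles the cases d = 0 and q = 0 where the ratios are undefined.
module Submission where

open import Defs
open import Data.Nat using (ℕ; zero; suc)
open import Data.Rational
  using (ℚ; 0ℚ; 1ℚ; _+_; _*_; _≤_; _<_; _⊔_; 1/_; NonZero; positive; nonNegative)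
open import Data.Rational.Properties
open import Data.Rational.Solver using (module +-*-Solver)
open import Data.Product using (∃; _×_; _,_)
open import Relation.Binary.Definitions using (tri<; tri≈; tri>)
open import Relation.Binary.PropositionalEquality using (_≡_; refl; sym; cong; subst)
open import Relation.Nullary using (¬_; contradiction)

open +-*-Solver using (solve; _:=_; _:*_; _:+_)
open ≤-Reasoning

_⁺ : ℚ → ℚ
p ⁺ = p ⊔ 0ℚ

⁺-nonNeg : ∀ p → 0ℚ ≤ p ⁺
⁺-nonNeg p = p≤q⊔p p 0ℚ

p≤p⁺ : ∀ p → p ≤ p ⁺
p≤p⁺ p = p≤p⊔q p 0ℚ

⟦⟧-nonNeg : ∀ n → 0ℚ ≤ ⟦ n ⟧
⟦⟧-nonNeg n = nonNegative⁻¹ ⟦ n ⟧ {{normalize-nonNeg n 1}}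

*-monoˡ-≤-≥0 : ∀ {r p q} → 0ℚ ≤ r → p ≤ q → r * p ≤ r * q
*-monoˡ-≤-≥0 {r} 0≤r = *-monoˡ-≤-nonNeg r {{nonNegative 0≤r}}

*-monoʳ-≤-≥0 : ∀ {r p q} → 0ℚ ≤ r → p ≤ q → p * r ≤ q * r
*-monoʳ-≤-≥0 {r} 0≤r = *-monoʳ-≤-nonNeg r {{nonNegative 0≤r}}

*-≥0 : ∀ {p q} → 0ℚ ≤ p → 0ℚ ≤ q → 0ℚ ≤ p * q
*-≥0 {p} 0≤p 0≤q = ≤-trans (≤-reflexive (sym (*-zeroʳ p))) (*-monoˡ-≤-≥0 0≤p 0≤q)

+-≥0 : ∀ {p q} → 0ℚ ≤ p → 0ℚ ≤ q → 0ℚ ≤ p + q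
+-≥0 = +-mono-≤

*-+-scaled-inverse : ∀ k .{{_ : NonZero k}} l e c x →
  k * l * (e + (c + x * 1/ k)) ≡ k * l * (e + c) + l * x
*-+-scaled-inverse k l e c x = begin-equality
  k * l * (e + (c + x * 1/ k))         ≡⟨ solve 6 (λ k l e c x i → k :* l :* (e :+ (c :+ x :* i))
                                                    := k :* l :* (e :+ c) :+ l :* x :* (k :* i))
                                                refl k l e c x (1/ k) ⟩
  k * l * (e + c) + l * x * (k * 1/ k) ≡⟨ cong (λ z → k * l * (e + c) + l * x * z) (*-inverseʳ k) ⟩
  k * l * (e + c) + l * x * 1ℚ         ≡⟨ cong (k * l * (e + c) +_) (*-identityʳ (l * x)) ⟩
  k * l * (e + c) + l * x              ∎

bound-through-ratio : ∀ {p q d e a b k l} →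
  0ℚ ≤ p → 0ℚ ≤ q → 0ℚ ≤ e → 0ℚ ≤ a → 0ℚ ≤ b → 0ℚ ≤ k → 0ℚ ≤ l →
  p ≤ a * q → q ≤ l * (d + b) → p * d ≤ k * (e * q) →
  p ≤ k * l * e + l * (a * b)
bound-through-ratio {p} {q} {d} {e} {a} {b} {k} {l} 0≤p 0≤q 0≤e 0≤a 0≤b 0≤k 0≤l p≤aq q≤ld pd≤keq
  with <-cmp 0ℚ q
... | tri> _ _ q<0 = contradiction (≤-<-trans 0≤q q<0) (<-irrefl refl)
... | tri≈ _ refl _ = begin
  p                            ≤⟨ p≤aq ⟩
  a * 0ℚ                       ≡⟨ *-zeroʳ a ⟩
  0ℚ                           ≤⟨ +-≥0 (*-≥0 (*-≥0 0≤k 0≤l) 0≤e) (*-≥0 0≤l (*-≥0 0≤a 0≤b)) ⟩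
  k * l * e + l * (a * b)      ∎
... | tri< 0<q _ _ = *-cancelˡ-≤-pos q {{positive 0<q}} (begin
  q * p                                 ≤⟨ *-monoʳ-≤-≥0 0≤p q≤ld ⟩
  l * (d + b) * p                       ≡⟨ solve 4 (λ l d b p → l :* (d :+ b) :* p := l :* (p :* d) :+ l :* (b :* p))
                                                 refl l d b p ⟩
  l * (p * d) + l * (b * p)             ≤⟨ +-mono-≤ (*-monoˡ-≤-≥0 0≤l pd≤keq)
                                                    (*-monoˡ-≤-≥0 0≤l (*-monoˡ-≤-≥0 0≤b p≤aq)) ⟩
  l * (k * (e * q)) + l * (b * (a * q)) ≡⟨ solve 6 (λ l k e q a b → l :* (k :* (e :* q)) :+ l :* (b :* (a :* q))
                                                      := q :* (k :* l :* e :+ l :* (a :* b)))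
                                                 refl l k e q a b ⟩
  q * (k * l * e + l * (a * b))         ∎)

-- When a ratio of relative competitiveness is undefined the bound still holds, once the
-- constant is made nonnegative: d = 0 makes the left side vanish, and q = 0 forces p = 0.
relative-bound-total : ∀ (p q d : ℕ) {a e c k} → 0ℚ ≤ k → 0ℚ ≤ e →
  ⟦ p ⟧ ≤ a * ⟦ q ⟧ →
  (¬ d ≡ 0 → ¬ q ≡ 0 → ⟦ p ⟧ * ⟦ d ⟧ ≤ k * ((e + c) * ⟦ q ⟧)) →
  ⟦ p ⟧ * ⟦ d ⟧ ≤ k * ((e + c ⁺) * ⟦ q ⟧)
relative-bound-total p zero d {a} {e} {c} {k} 0≤k 0≤e p≤aq _ = begin
  ⟦ p ⟧ * ⟦ d ⟧  ≤⟨ *-monoʳ-≤-≥0 (⟦⟧-nonNeg d) (≤-trans p≤aq (≤-reflexive (*-zeroʳ a))) ⟩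
  0ℚ * ⟦ d ⟧     ≡⟨ *-zeroˡ ⟦ d ⟧ ⟩
  0ℚ             ≤⟨ *-≥0 0≤k (*-≥0 (+-≥0 0≤e (⁺-nonNeg c)) (⟦⟧-nonNeg zero)) ⟩
  k * ((e + c ⁺) * ⟦ zero ⟧) ∎
relative-bound-total p (suc q) zero {e = e} {c} {k} 0≤k 0≤e _ _ = begin
  ⟦ p ⟧ * 0ℚ     ≡⟨ *-zeroʳ ⟦ p ⟧ ⟩
  0ℚ             ≤⟨ *-≥0 0≤k (*-≥0 (+-≥0 0≤e (⁺-nonNeg c)) (⟦⟧-nonNeg (suc q))) ⟩
  k * ((e + c ⁺) * ⟦ suc q ⟧) ∎
relative-bound-total p (suc q) (suc d) {e = e} {c} {k} 0≤k _ _ bound = begin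
  ⟦ p ⟧ * ⟦ suc d ⟧           ≤⟨ bound (λ ()) (λ ()) ⟩
  k * ((e + c) * ⟦ suc q ⟧)   ≤⟨ *-monoˡ-≤-≥0 0≤k (*-monoʳ-≤-≥0 (⟦⟧-nonNeg (suc q)) (+-monoʳ-≤ e (p≤p⁺ c))) ⟩
  k * ((e + c ⁺) * ⟦ suc q ⟧) ∎

module _ (M : Model) where
  open Model M

  feasible-nonNeg : ∀ {T U} → Feasible M T U →
    ∃ λ a → 0ℚ ≤ a × ∀ σ → ⟦ opt M T σ ⟧ ≤ a * ⟦ opt M U σ ⟧
  feasible-nonNeg {T} {U} (a , bound) = a ⁺ , ⁺-nonNeg a ,
    λ σ → ≤-trans (bound σ) (*-monoʳ-≤-≥0 (⟦⟧-nonNeg (opt M U σ)) (p≤p⁺ a))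

  competitive-nonNeg : ∀ {B U l} → 0ℚ ≤ l → Competitive M B U l →
    ∃ λ b → 0ℚ ≤ b × ∀ σ R → ReqOf U R → ⟦ opt M U σ ⟧ ≤ l * (⟦ done B σ R ⟧ + b)
  competitive-nonNeg {B} 0≤l (b , bound) = b ⁺ , ⁺-nonNeg b ,
    λ σ R R-U → ≤-trans (bound σ R R-U) (*-monoˡ-≤-≥0 0≤l (+-monoʳ-≤ ⟦ done B σ R ⟧ (p≤p⁺ b)))

  relCompetitive-total : ∀ {A T U k} → 0ℚ ≤ k → Feasible M T U → RelCompetitive M A T U k →
    ∃ λ c → 0ℚ ≤ c × ∀ B → Implements B U → ∀ σ R → ReqOf T R →
      ⟦ opt M T σ ⟧ * ⟦ done B σ (callReqs A σ R) ⟧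
        ≤ k * ((⟦ done (A ∘ᴬ B) σ R ⟧ + c) * ⟦ opt M U σ ⟧)
  relCompetitive-total {A} {T} {U} 0≤k (a , feasibleBound) (c , bound) = c ⁺ , ⁺-nonNeg c ,
    λ B implB σ R R-T → relative-bound-total (opt M T σ) (opt M U σ) (done B σ (callReqs A σ R))
      {a = a} 0≤k (⟦⟧-nonNeg (done (A ∘ᴬ B) σ R)) (feasibleBound σ) (bound B implB σ R R-T)

theorem1 : (M : Model) → let open Model M in
    (T U : Obj) (A B : Alg) (k l : ℚ) → 0ℚ < k → 0ℚ < l →
    Feasible M T U →
    Uses A T U → RelCompetitive M A T U k →
    Implements B U → Competitive M B U l →
    Competitive M (A ∘ᴬ B) T (k * l)
theorem1 M T U A B k l 0<k 0<l feasible uses relComp implB compB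
  with feasible-nonNeg M feasible
     | competitive-nonNeg M (<⇒≤ 0<l) compB
     | relCompetitive-total M (<⇒≤ 0<k) feasible relComp
... | a , 0≤a , feasibleBound | b , 0≤b , compBound | c , 0≤c , relBound =
  c + a * b * 1/ k , bound
  where
  open Model M
  instance
    k≢0 : NonZero k
    k≢0 = pos⇒nonZero k {{positive 0<k}}

  bound : ∀ σ R → ReqOf T R → ⟦ opt M T σ ⟧ ≤ k * l * (⟦ done (A ∘ᴬ B) σ R ⟧ + (c + a * b * 1/ k))
  bound σ R R-T = subst (⟦ opt M T σ ⟧ ≤_) (sym (*-+-scaled-inverse k l D c (a * b)))
    (bound-through-ratio (⟦⟧-nonNeg (opt M T σ)) (⟦⟧-nonNeg (opt M U σ))
      (+-≥0 (⟦⟧-nonNeg (done (A ∘ᴬ B) σ R)) 0≤c) 0≤a 0≤b (<⇒≤ 0<k) (<⇒≤ 0<l)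
      (feasibleBound σ)
      (compBound σ (callReqs A σ R) (callReqs-ReqOf uses R-T))
      (relBound B implB σ R R-T))
    where
    D : ℚ
    D = ⟦ done (A ∘ᴬ B) σ R ⟧
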